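{- Let $p$ be a prime with $p\neq 2$ and $p\neq 5$, and let $e$ be a positive integer. Then $l(p^e)$ equals the multiplicative order of $\alpha\bar\alpha^{ -1}$ in the group $(\mathbb{Z}[\alpha]/p^e\mathbb{Z}[\alpha])^\times$.
   Context: $\{F_n\}$ is the Fibonacci sequence with $F_0=0$, $F_1=1$, $F_n=F_{n-1}+F_{n-2}$ for $n\ge2$. For a positive integer $m$, $l(m)$ denotes the smallest positive integer $l$ such that $F_l\equiv 0 \pmod m$. Here $\alpha=(1+\sqrt5)/2$, $\bar\alpha=(1-\sqrt5)/2$, and $\mathbb{Z}[\alpha]$ is the ring of integers of $\mathbb{Q}(\sqrt5)$ (note $\alpha\bar\alpha=-1$, so $\bar\alpha$ is a unit). -}

module Defs where

open import Data.Nat as ℕ using (ℕ; zero; suc)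
open import Data.Integer as ℤ using (ℤ; +_; -[1+_])
open import Data.Integer.Divisibility using () renaming (_∣_ to _∣ℤ_)
open import Data.Nat.Divisibility using (_∣_)
open import Data.Product using (_×_; _,_)
open import Relation.Binary.PropositionalEquality using (_≡_; refl)

fib : ℕ → ℕ
fib zero = zero
fib (suc zero) = suc zero
fib (suc (suc n)) = fib (suc n) ℕ.+ fib n

IsRankOfApparition : ℕ → ℕ → Set
IsRankOfApparition m l =
  (0 ℕ.< l) × (m ∣ fib l) × (∀ k → 0 ℕ.< k → m ∣ fib k → l ℕ.≤ k)

-- The ring ℤ[α], α = (1+√5)/2, α² = α + 1.  ⟨ a , b ⟩ represents a + b α.
record ℤ[α] : Set where
  constructor ⟨_,_⟩
  field
    re : ℤ
    im : ℤ
open ℤ[α] public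

oneα : ℤ[α]
oneα = ⟨ + 1 , + 0 ⟩

infixl 7 _*α_
_*α_ : ℤ[α] → ℤ[α] → ℤ[α]
⟨ a , b ⟩ *α ⟨ c , d ⟩ =
  ⟨ a ℤ.* c ℤ.+ b ℤ.* d , a ℤ.* d ℤ.+ b ℤ.* c ℤ.+ b ℤ.* d ⟩

infixr 8 _^α_
_^α_ : ℤ[α] → ℕ → ℤ[α]
x ^α zero = oneα
x ^α suc k = x *α (x ^α k)

α : ℤ[α]
α = ⟨ + 0 , + 1 ⟩

-- ᾱ = (1 - √5)/2 = 1 - α
ᾱ : ℤ[α]
ᾱ = ⟨ + 1 , -[1+ 0 ] ⟩

-- ᾱ⁻¹ = -α, since α ᾱ = -1
ᾱ⁻¹ : ℤ[α]
ᾱ⁻¹ = ⟨ + 0 , -[1+ 0 ] ⟩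

ᾱ*ᾱ⁻¹≡1 : ᾱ *α ᾱ⁻¹ ≡ oneα
ᾱ*ᾱ⁻¹≡1 = refl

ᾱ⁻¹*ᾱ≡1 : ᾱ⁻¹ *α ᾱ ≡ oneα
ᾱ⁻¹*ᾱ≡1 = refl

infix 4 _≡α_[mod_]
_≡α_[mod_] : ℤ[α] → ℤ[α] → ℕ → Set
x ≡α y [mod m ] = ((+ m) ∣ℤ (re x ℤ.- re y)) × ((+ m) ∣ℤ (im x ℤ.- im y))

IsMulOrder : ℕ → ℤ[α] → ℕ → Set
IsMulOrder m x k =
  (0 ℕ.< k) × (x ^α k ≡α oneα [mod m ]) × (∀ j → 0 ℕ.< j → x ^α j ≡α oneα [mod m ] → k ℕ.≤ j)

{-# OPTIONS --safe #-}
module Submission where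

-- Put x = α ᾱ⁻¹. Then xⁿ − 1 = (αⁿ − ᾱⁿ) ᾱ⁻ⁿ = √5 Fₙ (−α)ⁿ, so xⁿ − 1 = Fₙ (Uₙ + Vₙ α)
-- with integers Uₙ, Vₙ that are coprime by Cassini's identity. Hence xⁿ ≡ 1 (mod m)
-- iff m ∣ Fₙ, and the least positive exponents for the two conditions coincide; one
-- exists because (Fₙ, Fₙ₊₁) mod m is periodic and the recurrence can be run backwards.
-- This works for every nonzero modulus m; of the hypotheses only p ≠ 0 (from primality) is used.

open import Defs
open import Data.Nat as ℕ using (ℕ; zero; suc; _^_; _<_; _≤_; _∸_; z≤n; s≤s; NonZero)
open import Data.Nat.Properties using (≮⇒≥; m<1+n⇒m<n∨m≡n; n<1+n; <⇒≤; m<n⇒0<n∸m; m^n≢0)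
open import Data.Nat.Divisibility using (_∣_; _∣?_)
open import Data.Nat.DivMod using (_%_; _/_; _mod_; m≡m%n+[m/n]*n)
open import Data.Nat.Primality using (Prime; prime⇒nonZero)
open import Data.Integer using (ℤ; +_; 1ℤ; _+_; _-_; _*_; -_)
open import Data.Integer.Properties using (pos-*; *-identityʳ)
open import Data.Integer.Divisibility.Signed renaming (_∣_ to _∣ℤ_)
  using (divides; ∣ᵤ⇒∣; ∣⇒∣ᵤ; ∣m⇒∣-m; ∣m∣n⇒∣m-n; ∣m⇒∣m*n)
open import Data.Integer.Tactic.RingSolver using (solve-∀)
open import Data.Fin using (Fin; toℕ; combine)
open import Data.Fin.Properties using (pigeonhole; combine-injective; toℕ-fromℕ<)
open import Data.Product using (Σ; _×_; _,_; proj₂)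
open import Data.Sum using (_⊎_; inj₁; inj₂; [_,_])
open import Function.Base using (_∘_)
open import Function.Bundles using (_⇔_; mk⇔; Equivalence)
open import Relation.Nullary using (¬_; yes; no; contradiction)
open import Relation.Nullary.Decidable using (_×-dec_)
open import Relation.Unary using (Decidable)
open import Relation.Binary.PropositionalEquality
  using (_≡_; _≢_; refl; sym; trans; cong; cong₂; subst; module ≡-Reasoning)

IsLeast : (ℕ → Set) → ℕ → Set
IsLeast P n = P n × (∀ k → P k → n ≤ k)

module _ {P : ℕ → Set} (P? : Decidable P) where

  least-or-none-below : ∀ n → Σ ℕ (IsLeast P) ⊎ (∀ k → k < n → ¬ P k)
  least-or-none-below zero = inj₂ λ _ ()
  least-or-none-below (suc n) with least-or-none-below n
  ... | inj₁ least = inj₁ least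
  ... | inj₂ none with P? n
  ...   | yes pn = inj₁ (n , pn , λ k pk → ≮⇒≥ λ k<n → none k k<n pk)
  ...   | no ¬pn = inj₂ λ k k<1+n → [ none k , (λ { refl → ¬pn }) ] (m<1+n⇒m<n∨m≡n k<1+n)

  least-exists : ∀ {n} → P n → Σ ℕ (IsLeast P)
  least-exists {n} pn with least-or-none-below (suc n)
  ... | inj₁ least = least
  ... | inj₂ none = contradiction pn (none n (n<1+n n))

fibℤ : ℕ → ℤ
fibℤ n = + fib n

[-1]^_ : ℕ → ℤ
[-1]^ zero = 1ℤ
[-1]^ suc n = - [-1]^ n

[-1]^-square : ∀ n → [-1]^ n * [-1]^ n ≡ 1ℤ
[-1]^-square zero = refl
[-1]^-square (suc n) = trans (neg*neg ([-1]^ n)) ([-1]^-square n)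
  where
  neg*neg : ∀ s → - s * - s ≡ s * s
  neg*neg = solve-∀

cassini : ∀ n → fibℤ (suc n) * fibℤ (suc n) - fibℤ (suc n) * fibℤ n - fibℤ n * fibℤ n ≡ [-1]^ n
cassini zero = refl
cassini (suc n) = trans (step (fibℤ n) (fibℤ (suc n))) (cong -_ (cassini n))
  where
  step : ∀ F G → (G + F) * (G + F) - (G + F) * G - G * G ≡ - (G * G - G * F - F * F)
  step = solve-∀

cassini-normalised : ∀ n →
  [-1]^ n * (fibℤ (suc n) * fibℤ (suc n) - fibℤ (suc n) * fibℤ n - fibℤ n * fibℤ n) ≡ 1ℤ
cassini-normalised n = trans (cong ([-1]^ n *_) (cassini n)) ([-1]^-square n)

αᾱ⁻¹ : ℤ[α]
αᾱ⁻¹ = α *α ᾱ⁻¹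

-- Uₙ + Vₙ α = √5 (−α)ⁿ, using √5 = 2α − 1 and (−α)ⁿ = (−1)ⁿ (Fₙ₋₁ + Fₙ α).
U V : ℕ → ℤ
U n = [-1]^ n * (+ 3 * fibℤ n - fibℤ (suc n))
V n = [-1]^ n * (+ 2 * fibℤ (suc n) - fibℤ n)

U-V-bezout : ∀ n → fibℤ n * V n - fibℤ (suc n) * U n ≡ 1ℤ
U-V-bezout n = trans (expand (fibℤ n) (fibℤ (suc n)) ([-1]^ n)) (cassini-normalised n)
  where
  expand : ∀ F G s → F * (s * (+ 2 * G - F)) - G * (s * (+ 3 * F - G)) ≡ s * (G * G - G * F - F * F)
  expand = solve-∀

αᾱ⁻¹-pow : ∀ n → αᾱ⁻¹ ^α n ≡ ⟨ + 1 + fibℤ n * U n , fibℤ n * V n ⟩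
αᾱ⁻¹-pow zero = refl
αᾱ⁻¹-pow (suc n) rewrite αᾱ⁻¹-pow n = cong₂ ⟨_,_⟩
    (trans (re-step F G s) (drop-multiple (+ 2) (cassini-normalised n)))
    (trans (im-step F G s) (drop-multiple 1ℤ (cassini-normalised n)))
  where
  F = fibℤ n
  G = fibℤ (suc n)
  s = [-1]^ n
  -- The recurrence for the coordinates holds only up to a multiple of (Cassini − 1).
  drop-multiple : ∀ {R X} c → X ≡ 1ℤ → R + c * (X - 1ℤ) ≡ R
  drop-multiple {R} c refl = vanish R c
    where
    vanish : ∀ R c → R + c * (1ℤ - 1ℤ) ≡ R
    vanish = solve-∀
  re-step : ∀ F G s →
    - 1ℤ * (+ 1 + F * (s * (+ 3 * F - G))) + - 1ℤ * (F * (s * (+ 2 * G - F)))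
    ≡ (+ 1 + G * (- s * (+ 3 * G - (G + F)))) + + 2 * (s * (G * G - G * F - F * F) - 1ℤ)
  re-step = solve-∀
  im-step : ∀ F G s →
    - 1ℤ * (F * (s * (+ 2 * G - F))) + - 1ℤ * (+ 1 + F * (s * (+ 3 * F - G))) + - 1ℤ * (F * (s * (+ 2 * G - F)))
    ≡ G * (- s * (+ 2 * (G + F) - G)) + 1ℤ * (s * (G * G - G * F - F * F) - 1ℤ)
  im-step = solve-∀

one+≡α-one⇔∣ : ∀ {m a b} → (⟨ + 1 + a , b ⟩ ≡α oneα [mod m ]) ⇔ (+ m ∣ℤ a × + m ∣ℤ b)
one+≡α-one⇔∣ {m} {a} {b} = mk⇔
  (λ (m∣a , m∣b) → subst (+ m ∣ℤ_) (re-diff a) (∣ᵤ⇒∣ m∣a) , subst (+ m ∣ℤ_) (im-diff b) (∣ᵤ⇒∣ m∣b))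
  (λ (m∣a , m∣b) → ∣⇒∣ᵤ (subst (+ m ∣ℤ_) (sym (re-diff a)) m∣a) , ∣⇒∣ᵤ (subst (+ m ∣ℤ_) (sym (im-diff b)) m∣b))
  where
  re-diff : ∀ a → + 1 + a - + 1 ≡ a
  re-diff = solve-∀
  im-diff : ∀ b → b - + 0 ≡ b
  im-diff = solve-∀

∣fib⇒αᾱ⁻¹^≡1 : ∀ m n → m ∣ fib n → αᾱ⁻¹ ^α n ≡α oneα [mod m ]
∣fib⇒αᾱ⁻¹^≡1 m n m∣Fₙ rewrite αᾱ⁻¹-pow n =
  Equivalence.from one+≡α-one⇔∣ (∣m⇒∣m*n (U n) m∣Fₙ′ , ∣m⇒∣m*n (V n) m∣Fₙ′)
  where
  m∣Fₙ′ : + m ∣ℤ fibℤ n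
  m∣Fₙ′ = ∣ᵤ⇒∣ m∣Fₙ

αᾱ⁻¹^≡1⇒∣fib : ∀ m n → αᾱ⁻¹ ^α n ≡α oneα [mod m ] → m ∣ fib n
αᾱ⁻¹^≡1⇒∣fib m n xⁿ≡1 rewrite αᾱ⁻¹-pow n
  with Equivalence.to (one+≡α-one⇔∣ {a = fibℤ n * U n} {b = fibℤ n * V n}) xⁿ≡1
... | m∣FU , m∣FV =
  ∣⇒∣ᵤ (subst (+ m ∣ℤ_) combination (∣m∣n⇒∣m-n (∣m⇒∣m*n F m∣FV) (∣m⇒∣m*n G m∣FU)))
  where
  open ≡-Reasoning
  F = fibℤ n
  G = fibℤ (suc n)
  factor : ∀ F G u v → F * v * F - F * u * G ≡ F * (F * v - G * u)
  factor = solve-∀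
  combination : F * V n * F - F * U n * G ≡ F
  combination = begin
    F * V n * F - F * U n * G  ≡⟨ factor F G (U n) (V n) ⟩
    F * (F * V n - G * U n)    ≡⟨ cong (F *_) (U-V-bezout n) ⟩
    F * 1ℤ                     ≡⟨ *-identityʳ F ⟩
    F                          ∎

mod≡⇒∣- : ∀ M .{{_ : NonZero M}} a b → a mod M ≡ b mod M → + M ∣ℤ + a - + b
mod≡⇒∣- M a b a≡b = divides (+ (a / M) - + (b / M)) (begin
  + a - + b                                                    ≡⟨ cong₂ _-_ (split a a%M≡b%M) (split b refl) ⟩
  + r + + (a / M) * + M - (+ r + + (b / M) * + M)              ≡⟨ cancel (+ r) (+ (a / M)) (+ (b / M)) (+ M) ⟩
  (+ (a / M) - + (b / M)) * + M                                ∎)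
  where
  open ≡-Reasoning
  r = b % M
  a%M≡b%M : a % M ≡ r
  a%M≡b%M = trans (sym (toℕ-fromℕ< _)) (trans (cong toℕ a≡b) (toℕ-fromℕ< _))
  split : ∀ c → c % M ≡ r → + c ≡ + r + + (c / M) * + M
  split c c%M≡r = begin
    + c                              ≡⟨ cong +_ (m≡m%n+[m/n]*n c M) ⟩
    + (c % M) + + (c / M ℕ.* M)      ≡⟨ cong₂ _+_ (cong +_ c%M≡r) (pos-* (c / M) M) ⟩
    + r + + (c / M) * + M            ∎
  cancel : ∀ r x y k → r + x * k - (r + y * k) ≡ (x - y) * k
  cancel = solve-∀

-- The Fibonacci recurrence runs backwards: Fᵢ = Fᵢ₊₂ − Fᵢ₊₁.
fib-descent : ∀ {M i j} → i ≤ j → M ∣ℤ fibℤ i - fibℤ j → M ∣ℤ fibℤ (suc i) - fibℤ (suc j) →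
  M ∣ℤ fibℤ (j ∸ i)
fib-descent {M} {j = j} z≤n M∣F₀-Fⱼ _ = subst (M ∣ℤ_) (neg-0- (fibℤ j)) (∣m⇒∣-m M∣F₀-Fⱼ)
  where
  neg-0- : ∀ x → - (+ 0 - x) ≡ x
  neg-0- = solve-∀
fib-descent {M} {suc i} {suc j} (s≤s i≤j) M∣Fᵢ₊₁-Fⱼ₊₁ M∣Fᵢ₊₂-Fⱼ₊₂ =
  fib-descent i≤j (subst (M ∣ℤ_) (backwards (fibℤ i) (fibℤ (suc i)) (fibℤ j) (fibℤ (suc j)))
                     (∣m∣n⇒∣m-n M∣Fᵢ₊₂-Fⱼ₊₂ M∣Fᵢ₊₁-Fⱼ₊₁))
                  M∣Fᵢ₊₁-Fⱼ₊₁
  where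
  backwards : ∀ a b c d → (b + a) - (d + c) - (b - d) ≡ a - c
  backwards = solve-∀

fib-residues : ∀ M .{{_ : NonZero M}} → ℕ → Fin (M ℕ.* M)
fib-residues M t = combine (fib t mod M) (fib (suc t) mod M)

fib-residues-collision⇒∣ : ∀ M .{{_ : NonZero M}} {s t} → s < t →
  fib-residues M s ≡ fib-residues M t → M ∣ fib (t ∸ s)
fib-residues-collision⇒∣ M {s} s<t same with combine-injective (fib s mod M) _ _ _ same
... | Fₛ≡Fₜ , Fₛ₊₁≡Fₜ₊₁ =
  ∣⇒∣ᵤ (fib-descent (<⇒≤ s<t) (mod≡⇒∣- M _ _ Fₛ≡Fₜ) (mod≡⇒∣- M _ _ Fₛ₊₁≡Fₜ₊₁))

fib-vanishes-mod : ∀ M .{{_ : NonZero M}} → Σ ℕ λ n → 0 < n × M ∣ fib n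
fib-vanishes-mod M with pigeonhole (n<1+n (M ℕ.* M)) (fib-residues M ∘ toℕ)
... | i , j , i<j , same = toℕ j ∸ toℕ i , m<n⇒0<n∸m i<j , fib-residues-collision⇒∣ M i<j same

rank≡order : ∀ m .{{_ : NonZero m}} → Σ ℕ λ n → IsRankOfApparition m n × IsMulOrder m αᾱ⁻¹ n
rank≡order m =
  from-least (least-exists (λ k → (0 ℕ.<? k) ×-dec (m ∣? fib k)) (proj₂ (fib-vanishes-mod m)))
  where
  from-least : Σ ℕ (IsLeast λ k → 0 < k × m ∣ fib k) →
    Σ ℕ λ n → IsRankOfApparition m n × IsMulOrder m αᾱ⁻¹ n
  from-least (n , (0<n , m∣Fₙ) , least) =
    n , (0<n , m∣Fₙ , λ k 0<k m∣Fₖ → least k (0<k , m∣Fₖ))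
      , (0<n , ∣fib⇒αᾱ⁻¹^≡1 m n m∣Fₙ , λ k 0<k xᵏ≡1 → least k (0<k , αᾱ⁻¹^≡1⇒∣fib m k xᵏ≡1))

mainTheorem3 : (p e : ℕ) → Prime p → p ≢ 2 → p ≢ 5 → 0 < e →
    Σ ℕ (λ n → IsRankOfApparition (p ^ e) n × IsMulOrder (p ^ e) (α *α ᾱ⁻¹) n)
mainTheorem3 p e p-prime _ _ _ = rank≡order (p ^ e) {{m^n≢0 p e {{prime⇒nonZero p-prime}}}}
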